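{- Let $G$ be a finite simple undirected graph and let $H$ be obtained from $G$ by inserting a new vertex $v$ of degree $d$ (adjacent to exactly $d$ vertices of $G$). Then \[\operatorname{nlcw}(G)\le\operatorname{nlcw}(H)\le\operatorname{nlcw}(G)+d\quad\text{and}\quad \operatorname{cw}(G)\le\operatorname{cw}(H)\le\operatorname{cw}(G)+d.\]
   Context: Clique-width: for a positive integer $k$, $\mathrm{CW}_k$ is the smallest class of graphs whose vertices carry labels from $\{1,\dots,k\}$ that contains every single-vertex graph with any label and is closed under: disjoint union; relabeling $\rho_{a\to b}$ for $a\neq b$; and $\eta_{a,b}$ for $a\neq b$ (add all edges between vertices labeled $a$ and vertices labeled $b$). $\operatorname{cw}(G)$ is the least $k$ such that some labeling of $G$ lies in $\mathrm{CW}_k$. NLC-width: $\mathrm{NLC}_k$ is the smallest class of labeled graphs (labels in $\{1,\dots,k\}$) containing every single-vertex graph with any label and closed under: $G\times_S J$ for $S\subseteq\{1,\dots,k\}^2$ (disjoint union of vertex-disjoint $G$ and $J$ plus all edges $\{u,v\}$, $u\in V_G$, $v\in V_J$, $(\mathrm{lab}(u),\mathrm{lab}(v))\in S$); and $\circ_R$ for $R:\{1,\dots,k\}\to\{1,\dots,k\}$. $\operatorname{nlcw}(G)$ is the least $k$ such that some labeling of $G$ lies in $\mathrm{NLC}_k$. -}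

module Defs where

open import Data.Nat using (ℕ; zero; suc; _+_; _≤_)
open import Data.Fin using (Fin; zero; suc; splitAt; _≟_)
open import Data.Fin.Permutation using (Permutation′; _⟨$⟩ʳ_)
open import Data.Bool using (Bool; true; false; _∨_; _∧_; if_then_else_)
open import Data.Sum using (_⊎_; inj₁; inj₂)
open import Data.Product using (Σ; ∃; _×_; _,_)
open import Relation.Nullary using (¬_)
open import Relation.Nullary.Decidable using (⌊_⌋)
open import Relation.Binary.PropositionalEquality using (_≡_; refl; sym)

record Graph : Set where
  field
    n      : ℕ
    adj    : Fin n → Fin n → Bool
    adj-sym   : ∀ i j → adj i j ≡ adj j i
    adj-irrefl : ∀ i → adj i i ≡ false
open Graph public

_≅ᵣ_ : ∀ {n} → (Fin n → Fin n → Bool) → (G : Graph) → Set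
_≅ᵣ_ {n} A G = Σ (n ≡ Graph.n G) λ { refl →
  Σ (Permutation′ n) λ π → ∀ i j → A (π ⟨$⟩ʳ i) (π ⟨$⟩ʳ j) ≡ Graph.adj G i j }

record LGraph (k n : ℕ) : Set where
  constructor lgraph
  field
    ladj : Fin n → Fin n → Bool
    lab  : Fin n → Fin k
open LGraph public

_==_ : ∀ {k} → Fin k → Fin k → Bool
a == b = ⌊ a ≟ b ⌋

joinAdj : ∀ {m n} → (Fin m → Fin m → Bool) → (Fin n → Fin n → Bool)
        → (Fin m → Fin n → Bool) → Fin (m + n) → Fin (m + n) → Bool
joinAdj {m} A B C x y with splitAt m x | splitAt m y
... | inj₁ u | inj₁ v = A u v
... | inj₂ u | inj₂ v = B u v
... | inj₁ u | inj₂ v = C u v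
... | inj₂ u | inj₁ v = C v u

joinLab : ∀ {k m n} → (Fin m → Fin k) → (Fin n → Fin k) → Fin (m + n) → Fin k
joinLab {m = m} f g x with splitAt m x
... | inj₁ u = f u
... | inj₂ u = g u

data CWExpr (k : ℕ) : ℕ → Set where
  cw-vertex : Fin k → CWExpr k 1
  cw-union  : ∀ {m n} → CWExpr k m → CWExpr k n → CWExpr k (m + n)
  cw-relab  : ∀ {n} (a b : Fin k) → ¬ (a ≡ b) → CWExpr k n → CWExpr k n
  cw-edges  : ∀ {n} (a b : Fin k) → ¬ (a ≡ b) → CWExpr k n → CWExpr k n

cwEval : ∀ {k n} → CWExpr k n → LGraph k n
cwEval (cw-vertex a) = lgraph (λ _ _ → false) (λ _ → a)
cwEval (cw-union e f) with cwEval e | cwEval f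
... | lgraph A la | lgraph B lb = lgraph (joinAdj A B (λ _ _ → false)) (joinLab la lb)
cwEval (cw-relab a b _ e) with cwEval e
... | lgraph A l = lgraph A (λ x → if l x == a then b else l x)
cwEval (cw-edges a b _ e) with cwEval e
... | lgraph A l = lgraph
  (λ x y → A x y ∨ ((l x == a) ∧ (l y == b)) ∨ ((l x == b) ∧ (l y == a))) l

HasCW : ℕ → Graph → Set
HasCW k G = ∃ λ (e : CWExpr k (Graph.n G)) → ladj (cwEval e) ≅ᵣ G

IsCW : Graph → ℕ → Set
IsCW G c = HasCW c G × (∀ j → HasCW j G → c ≤ j)

data NLCExpr (k : ℕ) : ℕ → Set where
  nlc-vertex : Fin k → NLCExpr k 1
  nlc-join   : ∀ {m n} → (Fin k → Fin k → Bool) → NLCExpr k m → NLCExpr k n → NLCExpr k (m + n)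
  nlc-relab  : ∀ {n} → (Fin k → Fin k) → NLCExpr k n → NLCExpr k n

nlcEval : ∀ {k n} → NLCExpr k n → LGraph k n
nlcEval (nlc-vertex a) = lgraph (λ _ _ → false) (λ _ → a)
nlcEval (nlc-join S e f) with nlcEval e | nlcEval f
... | lgraph A la | lgraph B lb =
  lgraph (joinAdj A B (λ u v → S (la u) (lb v))) (joinLab la lb)
nlcEval (nlc-relab R e) with nlcEval e
... | lgraph A l = lgraph A (λ x → R (l x))

HasNLC : ℕ → Graph → Set
HasNLC k G = ∃ λ (e : NLCExpr k (Graph.n G)) → ladj (nlcEval e) ≅ᵣ G

IsNLCW : Graph → ℕ → Set
IsNLCW G c = HasNLC c G × (∀ j → HasNLC j G → c ≤ j)

count : ∀ {n} → (Fin n → Bool) → ℕ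
count {zero} _ = 0
count {suc n} N = (if N zero then 1 else 0) + count (λ i → N (suc i))

private
  insAdj : ∀ {n} → (Fin n → Fin n → Bool) → (Fin n → Bool) → Fin (suc n) → Fin (suc n) → Bool
  insAdj A N zero zero = false
  insAdj A N zero (suc j) = N j
  insAdj A N (suc i) zero = N i
  insAdj A N (suc i) (suc j) = A i j

insertVertex : (G : Graph) → (Fin (Graph.n G) → Bool) → Graph
insertVertex G N = record
  { n = suc (Graph.n G)
  ; adj = insAdj (Graph.adj G) N
  ; adj-sym = s
  ; adj-irrefl = ir }
  where
  s : ∀ i j → insAdj (Graph.adj G) N i j ≡ insAdj (Graph.adj G) N j i
  s zero zero = refl
  s zero (suc j) = refl
  s (suc i) zero = refl
  s (suc i) (suc j) = Graph.adj-sym G i j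
  ir : ∀ i → insAdj (Graph.adj G) N i i ≡ false
  ir zero = refl
  ir (suc i) = Graph.adj-irrefl G i

{-# OPTIONS --safe #-}
module Submission where

-- Lower bounds: commuting the operands of unions (joins), a k-expression for
-- H can be rearranged so that the new vertex v is its first leaf; dropping
-- that leaf leaves a k-expression for G.
--
-- Upper bounds: one extra label isolates a vertex y of a k-expression for the
-- whole construction.  y gets the private label zero, all other labels are
-- shifted up by one, and every operation that would have affected y through
-- its current label is replayed for the private label.  Isolating the d
-- neighbours of v makes them recognisable by their labels at the root, where
-- for NLC-width a single join adds v.  For clique-width v needs a label of its
-- own: it is created at the leaf of one neighbour u, with one fresh label, and
-- only the other d - 1 neighbours are isolated; at the root the label of v is
-- joined to their private labels.

open import Defs
open import Data.Nat using (ℕ; zero; suc; _+_; _≤_; pred)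
open import Data.Nat.Properties using (+-comm; +-suc; +-identityʳ)
open import Data.Fin using (Fin; zero; suc; splitAt; join; _↑ˡ_; _↑ʳ_; _≟_)
open import Data.Fin.Properties
  using ( 0≢1+n; suc-injective; ↑ʳ-injective; any?
        ; splitAt-↑ˡ; splitAt-↑ʳ; splitAt⁻¹-↑ˡ; splitAt⁻¹-↑ʳ; +↔⊎)
open import Data.Fin.Permutation
  using (Permutation; Permutation′; _⟨$⟩ʳ_; lift₀; id; _∘ₚ_; remove; lift₀-remove; ↔⇒≡)
open import Data.Bool using (Bool; true; false; _∨_; _∧_; if_then_else_)
open import Data.Bool.Properties using (∨-zeroʳ; ∨-identityʳ; ∧-zeroʳ; ∨-assoc; if-float)
open import Data.Bool.Solver using (module ∨-∧-Solver)
open ∨-∧-Solver using (solve; _:+_; _:*_; _:=_; con)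
open import Data.Product using (Σ; ∃; _×_; _,_; proj₁; proj₂)
open import Data.Sum using (inj₁; inj₂)
import Data.Sum as Sum
open import Data.Sum.Function.Propositional using (_⊎-↔_)
open import Data.Sum.Algebra using (⊎-comm)
open import Function using (_∘_; _on_; flip; Injective)
open import Function.Bundles using (module Injection)
open import Function.Properties.Inverse using (↔-trans; ↔-sym; ↔⇒↣)
open import Relation.Nullary using (yes; no; contradiction)
open import Relation.Nullary.Decidable using (isYes≗does; dec-true; dec-false)
open import Relation.Binary.PropositionalEquality

private
  variable
    k m p m′ p′ : ℕ

==-refl : (a : Fin k) → (a == a) ≡ true
==-refl a = trans (isYes≗does (a ≟ a)) (dec-true (a ≟ a) refl)

==-≢ : {a b : Fin k} → a ≢ b → (a == b) ≡ false
==-≢ {a = a} {b} a≢b = trans (isYes≗does (a ≟ b)) (dec-false (a ≟ b) a≢b)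

==-sym : (a b : Fin k) → (a == b) ≡ (b == a)
==-sym a b with a ≟ b
... | yes refl = sym (==-refl a)
... | no a≢b = sym (==-≢ (a≢b ∘ sym))

==-injective : ∀ {n} {f : Fin m → Fin n} → Injective _≡_ _≡_ f → (a b : Fin m) → (f a == f b) ≡ (a == b)
==-injective f-inj a b with a ≟ b
... | yes refl = ==-refl _
... | no a≢b = ==-≢ (a≢b ∘ f-inj)

==-suc : (a b : Fin k) → (suc a == suc b) ≡ (a == b)
==-suc = ==-injective suc-injective

data SplitView (m p : ℕ) : Fin (m + p) → Set where
  inl : (u : Fin m) → SplitView m p (u ↑ˡ p)
  inr : (w : Fin p) → SplitView m p (m ↑ʳ w)

splitView : ∀ m p i → SplitView m p i
splitView m p i with splitAt m i in eq
... | inj₁ u = subst (SplitView m p) (splitAt⁻¹-↑ˡ eq) (inl u)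
... | inj₂ w = subst (SplitView m p) (splitAt⁻¹-↑ʳ eq) (inr w)

↑ˡ≢↑ʳ : (u : Fin m) (w : Fin p) → u ↑ˡ p ≢ m ↑ʳ w
↑ˡ≢↑ʳ {m} {p} u w eq with trans (sym (splitAt-↑ˡ m u p)) (trans (cong (splitAt m) eq) (splitAt-↑ʳ m p w))
... | ()

module _ (A : Fin m → Fin m → Bool) (B : Fin p → Fin p → Bool) (C : Fin m → Fin p → Bool) where

  joinAdj-↑ˡ-↑ˡ : ∀ u v → joinAdj A B C (u ↑ˡ p) (v ↑ˡ p) ≡ A u v
  joinAdj-↑ˡ-↑ˡ u v rewrite splitAt-↑ˡ m u p | splitAt-↑ˡ m v p = refl

  joinAdj-↑ˡ-↑ʳ : ∀ u w → joinAdj A B C (u ↑ˡ p) (m ↑ʳ w) ≡ C u w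
  joinAdj-↑ˡ-↑ʳ u w rewrite splitAt-↑ˡ m u p | splitAt-↑ʳ m p w = refl

  joinAdj-↑ʳ-↑ˡ : ∀ w u → joinAdj A B C (m ↑ʳ w) (u ↑ˡ p) ≡ C u w
  joinAdj-↑ʳ-↑ˡ w u rewrite splitAt-↑ˡ m u p | splitAt-↑ʳ m p w = refl

  joinAdj-↑ʳ-↑ʳ : ∀ w w′ → joinAdj A B C (m ↑ʳ w) (m ↑ʳ w′) ≡ B w w′
  joinAdj-↑ʳ-↑ʳ w w′ rewrite splitAt-↑ʳ m p w | splitAt-↑ʳ m p w′ = refl

joinAdj-cong : {A A′ : Fin m → Fin m → Bool} {B B′ : Fin p → Fin p → Bool} {C C′ : Fin m → Fin p → Bool} →
               (∀ u v → A u v ≡ A′ u v) → (∀ w w′ → B w w′ ≡ B′ w w′) → (∀ u w → C u w ≡ C′ u w) →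
               ∀ x y → joinAdj A B C x y ≡ joinAdj A′ B′ C′ x y
joinAdj-cong {m} {p} {A} {A′} {B} {B′} {C} {C′} A≗A′ B≗B′ C≗C′ x y with splitView m p x | splitView m p y
... | inl u | inl v rewrite joinAdj-↑ˡ-↑ˡ A B C u v | joinAdj-↑ˡ-↑ˡ A′ B′ C′ u v = A≗A′ u v
... | inl u | inr w rewrite joinAdj-↑ˡ-↑ʳ A B C u w | joinAdj-↑ˡ-↑ʳ A′ B′ C′ u w = C≗C′ u w
... | inr w | inl u rewrite joinAdj-↑ʳ-↑ˡ A B C w u | joinAdj-↑ʳ-↑ˡ A′ B′ C′ w u = C≗C′ u w
... | inr w | inr w′ rewrite joinAdj-↑ʳ-↑ʳ A B C w w′ | joinAdj-↑ʳ-↑ʳ A′ B′ C′ w w′ = B≗B′ w w′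

module _ (f : Fin m → Fin k) (g : Fin p → Fin k) where

  joinLab-↑ˡ : ∀ u → joinLab f g (u ↑ˡ p) ≡ f u
  joinLab-↑ˡ u rewrite splitAt-↑ˡ m u p = refl

  joinLab-↑ʳ : ∀ w → joinLab f g (m ↑ʳ w) ≡ g w
  joinLab-↑ʳ w rewrite splitAt-↑ʳ m p w = refl

module _ {k′} {f : Fin m → Fin k} {g : Fin p → Fin k} {f′ : Fin m → Fin k′} {g′ : Fin p → Fin k′}
         (h : Fin k → Fin k′) where

  joinLab-∘-↑ˡ : ∀ u → f′ u ≡ h (f u) → joinLab f′ g′ (u ↑ˡ p) ≡ h (joinLab f g (u ↑ˡ p))
  joinLab-∘-↑ˡ u eq rewrite joinLab-↑ˡ f′ g′ u | joinLab-↑ˡ f g u = eq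

  joinLab-∘-↑ʳ : ∀ w → g′ w ≡ h (g w) → joinLab f′ g′ (m ↑ʳ w) ≡ h (joinLab f g (m ↑ʳ w))
  joinLab-∘-↑ʳ w eq rewrite joinLab-↑ʳ f′ g′ w | joinLab-↑ʳ f g w = eq

  joinLab-∘ : (∀ u → f′ u ≡ h (f u)) → (∀ w → g′ w ≡ h (g w)) → ∀ x → joinLab f′ g′ x ≡ h (joinLab f g x)
  joinLab-∘ f′≗hf g′≗hg x with splitView m p x
  ... | inl u = joinLab-∘-↑ˡ u (f′≗hf u)
  ... | inr w = joinLab-∘-↑ʳ w (g′≗hg w)

_⊕ᶠ_ : (Fin m → Fin m′) → (Fin p → Fin p′) → Fin (m + p) → Fin (m′ + p′)
_⊕ᶠ_ {m} {m′} {p} {p′} f g = join m′ p′ ∘ Sum.map f g ∘ splitAt m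

module _ (f : Fin m → Fin m′) (g : Fin p → Fin p′) where

  ⊕ᶠ-↑ˡ : ∀ u → (f ⊕ᶠ g) (u ↑ˡ p) ≡ f u ↑ˡ p′
  ⊕ᶠ-↑ˡ u rewrite splitAt-↑ˡ m u p = refl

  ⊕ᶠ-↑ʳ : ∀ w → (f ⊕ᶠ g) (m ↑ʳ w) ≡ m′ ↑ʳ g w
  ⊕ᶠ-↑ʳ w rewrite splitAt-↑ʳ m p w = refl

swapᶠ : ∀ m p → Fin (m + p) → Fin (p + m)
swapᶠ m p = join p m ∘ Sum.swap ∘ splitAt m

swapᶠ-↑ˡ : ∀ u → swapᶠ m p (u ↑ˡ p) ≡ p ↑ʳ u
swapᶠ-↑ˡ {m} {p} u rewrite splitAt-↑ˡ m u p = refl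

swapᶠ-↑ʳ : ∀ w → swapᶠ m p (m ↑ʳ w) ≡ w ↑ˡ m
swapᶠ-↑ʳ {m} {p} w rewrite splitAt-↑ʳ m p w = refl

-- Definitionally, σ ⊕ₚ τ acts as (σ ⟨$⟩ʳ_) ⊕ᶠ (τ ⟨$⟩ʳ_) and swapₚ m p as swapᶠ m p.
_⊕ₚ_ : Permutation m m′ → Permutation p p′ → Permutation (m + p) (m′ + p′)
σ ⊕ₚ τ = ↔-trans +↔⊎ (↔-trans (σ ⊎-↔ τ) (↔-sym +↔⊎))

swapₚ : ∀ m p → Permutation (m + p) (p + m)
swapₚ m p = ↔-trans (+↔⊎ {m} {p}) (↔-trans (⊎-comm _ _) (↔-sym (+↔⊎ {p} {m})))

sucᵖ : ∀ {N} → Fin (pred N) → Fin N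
sucᵖ {suc _} = suc

⊕ᶠ-suc : ∀ {m p} (i : Fin (m + p)) → (_⊕ᶠ_ {m} {suc m} {p} suc (λ w → w)) i ≡ suc i
⊕ᶠ-suc {m} {p} i with splitView m p i
... | inl u = ⊕ᶠ-↑ˡ suc (λ w → w) u
... | inr w = ⊕ᶠ-↑ʳ suc (λ w → w) w

inImage : ∀ {d n} → (Fin d → Fin n) → Fin n → Bool
inImage {zero} f x = false
inImage {suc d} f x = (f zero == x) ∨ inImage (f ∘ suc) x

inImage-∈ : ∀ {d n} (f : Fin d → Fin n) i → inImage f (f i) ≡ true
inImage-∈ f zero rewrite ==-refl (f zero) = refl
inImage-∈ f (suc i) rewrite inImage-∈ (f ∘ suc) i = ∨-zeroʳ _

inImage-∉ : ∀ {d n} {f : Fin d → Fin n} {x} → (∀ i → f i ≢ x) → inImage f x ≡ false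
inImage-∉ {zero} f∌x = refl
inImage-∉ {suc d} f∌x = cong₂ _∨_ (==-≢ (f∌x zero)) (inImage-∉ (f∌x ∘ suc))

inImage-∘ : ∀ {d n o} {g : Fin n → Fin o} → Injective _≡_ _≡_ g →
            (f : Fin d → Fin n) (x : Fin n) → inImage (g ∘ f) (g x) ≡ inImage f x
inImage-∘ {zero} g-inj f x = refl
inImage-∘ {suc d} g-inj f x = cong₂ _∨_ (==-injective g-inj (f zero) x) (inImage-∘ g-inj (f ∘ suc) x)

consIf : ∀ {c n} (b : Bool) → (Fin c → Fin n) → Fin ((if b then 1 else 0) + c) → Fin (suc n)
consIf true  f zero    = zero
consIf true  f (suc i) = suc (f i)
consIf false f i       = suc (f i)

enumerate : ∀ {n} (N : Fin n → Bool) → Fin (count N) → Fin n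
enumerate {zero}  N ()
enumerate {suc n} N = consIf (N zero) (enumerate (N ∘ suc))

enumerate-injective : ∀ {n} (N : Fin n → Bool) → Injective _≡_ _≡_ (enumerate N)
enumerate-injective {suc n} N = consIf-injective (N zero) (enumerate-injective (N ∘ suc))
  where
  consIf-injective : ∀ {c} {f : Fin c → Fin n} b → Injective _≡_ _≡_ f → Injective _≡_ _≡_ (consIf b f)
  consIf-injective true  f-inj {zero}  {zero}  _  = refl
  consIf-injective true  f-inj {suc i} {suc j} eq = cong suc (f-inj (suc-injective eq))
  consIf-injective false f-inj eq = f-inj (suc-injective eq)

module _ {c n : ℕ} where

  inImage-consIf-zero : ∀ b (f : Fin c → Fin n) → inImage (consIf b f) zero ≡ b
  inImage-consIf-zero true  f = refl
  inImage-consIf-zero false f = inImage-∉ {f = consIf false f} (λ i ())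

  inImage-consIf-suc : ∀ b (f : Fin c → Fin n) x → inImage (consIf b f) (suc x) ≡ inImage f x
  inImage-consIf-suc true  f x = inImage-∘ suc-injective f x
  inImage-consIf-suc false f x = inImage-∘ suc-injective f x

inImage-enumerate : ∀ {n} (N : Fin n → Bool) x → inImage (enumerate N) x ≡ N x
inImage-enumerate {suc n} N zero = inImage-consIf-zero (N zero) (enumerate (N ∘ suc))
inImage-enumerate {suc n} N (suc x) =
  trans (inImage-consIf-suc (N zero) (enumerate (N ∘ suc)) x) (inImage-enumerate (N ∘ suc) x)

record Enumeration {n} (N : Fin n → Bool) (d : ℕ) : Set where
  field
    element   : Fin d → Fin n
    injective : Injective _≡_ _≡_ element
    inImage-element : ∀ x → inImage element x ≡ N x

enumeration : ∀ {n} (N : Fin n → Bool) → Enumeration N (count N)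
enumeration N = record { element = enumerate N ; injective = enumerate-injective N ; inImage-element = inImage-enumerate N }

-- Definitionally, nlc-join S and nlc-relab R evaluate to joinLG S and relabelLG R
-- of the evaluated operands; cwEval is treated likewise in CliqueWidth.
joinLG : (Fin k → Fin k → Bool) → LGraph k m → LGraph k p → LGraph k (m + p)
joinLG S G H = lgraph (joinAdj (ladj G) (ladj H) (λ u w → S (lab G u) (lab H w))) (joinLab (lab G) (lab H))

relabelLG : ∀ {n} → (Fin k → Fin k) → LGraph k n → LGraph k n
relabelLG R G = lgraph (ladj G) (R ∘ lab G)

addEdgesLG : ∀ {n} → (Fin k → Fin k → Bool) → LGraph k n → LGraph k n
addEdgesLG P G = lgraph (λ x y → ladj G x y ∨ P (lab G x) (lab G y)) (lab G)

record _↪[_]_ {k m n} (G : LGraph k m) (ι : Fin m → Fin n) (H : LGraph k n) : Set where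
  field
    adj-↪ : ∀ i j → ladj H (ι i) (ι j) ≡ ladj G i j
    lab-↪ : ∀ i → lab H (ι i) ≡ lab G i
open _↪[_]_ public

↪-refl : ∀ {n} {G : LGraph k n} → G ↪[ (λ i → i) ] G
↪-refl = record { adj-↪ = λ _ _ → refl ; lab-↪ = λ _ → refl }

module _ {n o : ℕ} {G : LGraph k m} {H : LGraph k n} {K : LGraph k o} where

  ↪-trans : {ι : Fin m → Fin n} {κ : Fin n → Fin o} → G ↪[ ι ] H → H ↪[ κ ] K → G ↪[ κ ∘ ι ] K
  ↪-trans G↪H H↪K = record
    { adj-↪ = λ i j → trans (adj-↪ H↪K _ _) (adj-↪ G↪H i j)
    ; lab-↪ = λ i → trans (lab-↪ H↪K _) (lab-↪ G↪H i) }

module _ {n : ℕ} {G : LGraph k m} {H : LGraph k n} where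

  ↪-cong : {ι κ : Fin m → Fin n} → ι ≗ κ → G ↪[ ι ] H → G ↪[ κ ] H
  ↪-cong ι≗κ G↪H = record
    { adj-↪ = λ i j → trans (sym (cong₂ (ladj H) (ι≗κ i) (ι≗κ j))) (adj-↪ G↪H i j)
    ; lab-↪ = λ i → trans (sym (cong (lab H) (ι≗κ i))) (lab-↪ G↪H i) }

  relabelLG-↪ : ∀ {ι R} → G ↪[ ι ] H → relabelLG R G ↪[ ι ] relabelLG R H
  relabelLG-↪ {R = R} G↪H = record { adj-↪ = adj-↪ G↪H ; lab-↪ = λ i → cong R (lab-↪ G↪H i) }

  addEdgesLG-↪ : ∀ {ι P} → G ↪[ ι ] H → addEdgesLG P G ↪[ ι ] addEdgesLG P H
  addEdgesLG-↪ {P = P} G↪H = record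
    { adj-↪ = λ i j → cong₂ _∨_ (adj-↪ G↪H i j) (cong₂ P (lab-↪ G↪H i) (lab-↪ G↪H j))
    ; lab-↪ = lab-↪ G↪H }

module _ (S : Fin k → Fin k → Bool) (G : LGraph k m) (H : LGraph k p) where

  joinLG-↪ʳ : H ↪[ m ↑ʳ_ ] joinLG S G H
  joinLG-↪ʳ = record
    { adj-↪ = joinAdj-↑ʳ-↑ʳ (ladj G) (ladj H) _
    ; lab-↪ = joinLab-↑ʳ (lab G) (lab H) }

  joinLG-swap : joinLG S G H ↪[ swapᶠ m p ] joinLG (flip S) H G
  joinLG-swap = record { adj-↪ = adjacency ; lab-↪ = labels }
    where
    A = ladj G
    B = ladj H
    C = λ u w → S (lab G u) (lab H w)
    C′ = λ w u → S (lab G u) (lab H w)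
    adjacency : ∀ i j → ladj (joinLG (flip S) H G) (swapᶠ m p i) (swapᶠ m p j) ≡ ladj (joinLG S G H) i j
    adjacency i j with splitView m p i | splitView m p j
    ... | inl u | inl v rewrite swapᶠ-↑ˡ {m} {p} u | swapᶠ-↑ˡ {m} {p} v
          = trans (joinAdj-↑ʳ-↑ʳ B A C′ u v) (sym (joinAdj-↑ˡ-↑ˡ A B C u v))
    ... | inl u | inr w rewrite swapᶠ-↑ˡ {m} {p} u | swapᶠ-↑ʳ {m} {p} w
          = trans (joinAdj-↑ʳ-↑ˡ B A C′ u w) (sym (joinAdj-↑ˡ-↑ʳ A B C u w))
    ... | inr w | inl u rewrite swapᶠ-↑ʳ {m} {p} w | swapᶠ-↑ˡ {m} {p} u
          = trans (joinAdj-↑ˡ-↑ʳ B A C′ w u) (sym (joinAdj-↑ʳ-↑ˡ A B C w u))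
    ... | inr w | inr w′ rewrite swapᶠ-↑ʳ {m} {p} w | swapᶠ-↑ʳ {m} {p} w′
          = trans (joinAdj-↑ˡ-↑ˡ B A C′ w w′) (sym (joinAdj-↑ʳ-↑ʳ A B C w w′))
    labels : ∀ i → lab (joinLG (flip S) H G) (swapᶠ m p i) ≡ lab (joinLG S G H) i
    labels i with splitView m p i
    ... | inl u rewrite swapᶠ-↑ˡ {m} {p} u = trans (joinLab-↑ʳ (lab H) (lab G) u) (sym (joinLab-↑ˡ (lab G) (lab H) u))
    ... | inr w rewrite swapᶠ-↑ʳ {m} {p} w = trans (joinLab-↑ˡ (lab H) (lab G) w) (sym (joinLab-↑ʳ (lab G) (lab H) w))

module _ (S : Fin k → Fin k → Bool) {G₁ : LGraph k m} {H₁ : LGraph k m′} {G₂ : LGraph k p} {H₂ : LGraph k p′}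
         {ι₁ : Fin m → Fin m′} {ι₂ : Fin p → Fin p′} where

  joinLG-↪ : G₁ ↪[ ι₁ ] H₁ → G₂ ↪[ ι₂ ] H₂ → joinLG S G₁ G₂ ↪[ ι₁ ⊕ᶠ ι₂ ] joinLG S H₁ H₂
  joinLG-↪ G₁↪H₁ G₂↪H₂ = record { adj-↪ = adjacency ; lab-↪ = labels }
    where
    C = λ u w → S (lab G₁ u) (lab G₂ w)
    D = λ u w → S (lab H₁ u) (lab H₂ w)
    adjacency : ∀ i j → ladj (joinLG S H₁ H₂) ((ι₁ ⊕ᶠ ι₂) i) ((ι₁ ⊕ᶠ ι₂) j) ≡ ladj (joinLG S G₁ G₂) i j
    adjacency i j with splitView m p i | splitView m p j
    ... | inl u | inl v rewrite ⊕ᶠ-↑ˡ ι₁ ι₂ u | ⊕ᶠ-↑ˡ ι₁ ι₂ v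
                              | joinAdj-↑ˡ-↑ˡ (ladj H₁) (ladj H₂) D (ι₁ u) (ι₁ v)
                              | joinAdj-↑ˡ-↑ˡ (ladj G₁) (ladj G₂) C u v = adj-↪ G₁↪H₁ u v
    ... | inl u | inr w rewrite ⊕ᶠ-↑ˡ ι₁ ι₂ u | ⊕ᶠ-↑ʳ ι₁ ι₂ w
                              | joinAdj-↑ˡ-↑ʳ (ladj H₁) (ladj H₂) D (ι₁ u) (ι₂ w)
                              | joinAdj-↑ˡ-↑ʳ (ladj G₁) (ladj G₂) C u w = cong₂ S (lab-↪ G₁↪H₁ u) (lab-↪ G₂↪H₂ w)
    ... | inr w | inl u rewrite ⊕ᶠ-↑ʳ ι₁ ι₂ w | ⊕ᶠ-↑ˡ ι₁ ι₂ u
                              | joinAdj-↑ʳ-↑ˡ (ladj H₁) (ladj H₂) D (ι₂ w) (ι₁ u)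
                              | joinAdj-↑ʳ-↑ˡ (ladj G₁) (ladj G₂) C w u = cong₂ S (lab-↪ G₁↪H₁ u) (lab-↪ G₂↪H₂ w)
    ... | inr w | inr w′ rewrite ⊕ᶠ-↑ʳ ι₁ ι₂ w | ⊕ᶠ-↑ʳ ι₁ ι₂ w′
                               | joinAdj-↑ʳ-↑ʳ (ladj H₁) (ladj H₂) D (ι₂ w) (ι₂ w′)
                               | joinAdj-↑ʳ-↑ʳ (ladj G₁) (ladj G₂) C w w′ = adj-↪ G₂↪H₂ w w′
    labels : ∀ i → lab (joinLG S H₁ H₂) ((ι₁ ⊕ᶠ ι₂) i) ≡ lab (joinLG S G₁ G₂) i
    labels i with splitView m p i
    ... | inl u rewrite ⊕ᶠ-↑ˡ ι₁ ι₂ u | joinLab-↑ˡ (lab H₁) (lab H₂) (ι₁ u) | joinLab-↑ˡ (lab G₁) (lab G₂) u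
          = lab-↪ G₁↪H₁ u
    ... | inr w rewrite ⊕ᶠ-↑ʳ ι₁ ι₂ w | joinLab-↑ʳ (lab H₁) (lab H₂) (ι₂ w) | joinLab-↑ʳ (lab G₁) (lab G₂) w
          = lab-↪ G₂↪H₂ w

-- Reads the private label zero as c, the label of the isolated vertex in the
-- original expression.
decode : ∀ {k} → Fin k → Fin (suc k) → Fin k
decode c zero    = c
decode c (suc a) = a

decode-isolated : ∀ {k n} {l : Fin n → Fin k} {l′ : Fin n → Fin (suc k)} {y} →
                  l′ y ≡ zero → (∀ {x} → x ≢ y → l′ x ≡ suc (l x)) → ∀ x → decode (l y) (l′ x) ≡ l x
decode-isolated {y = y} self other x with x ≟ y
... | yes refl rewrite self = refl
... | no x≢y rewrite other x≢y = refl

module Expressions {Expr : ℕ → ℕ → Set} (eval : ∀ {k n} → Expr k n → LGraph k n) where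

  -- HasCW is Expressible for cwEval, HasNLC for nlcEval.
  Expressible : ℕ → Graph → Set
  Expressible k G = ∃ λ (e : Expr k (n G)) → ladj (eval e) ≅ᵣ G

  expressible-≅ : ∀ {k m} G (e : Expr k m) (π : Permutation (n G) m) →
                  (∀ i j → ladj (eval e) (π ⟨$⟩ʳ i) (π ⟨$⟩ʳ j) ≡ adj G i j) → Expressible k G
  expressible-≅ G e π h with ↔⇒≡ π
  ... | refl = e , refl , π , h

  record Front {k n} (e : Expr k n) (x : Fin n) : Set where
    field
      size   : ℕ
      expr   : Expr k (suc size)
      perm   : Permutation n (suc size)
      perm-x : perm ⟨$⟩ʳ x ≡ zero
      iso    : eval e ↪[ perm ⟨$⟩ʳ_ ] eval expr

  module Deletion
    (front : ∀ {k n} (e : Expr k n) x → Front e x)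
    -- the vertex only witnesses that e has a second vertex
    (dropFirst : ∀ {k n} (e : Expr k (suc n)) → Fin n → Σ (Expr k n) λ e′ → eval e′ ↪[ suc ] eval e)
    where

    expressible-deleteVertex : ∀ {k} G N → Fin (n G) → Expressible k (insertVertex G N) → Expressible k G
    expressible-deleteVertex {k} G N x (e , refl , π , h) = expressible-≅ G tail τ adj-τ
      where
      open Front (front e (π ⟨$⟩ʳ zero))
      ρ : Permutation (suc (n G)) (suc size)
      ρ = π ∘ₚ perm
      τ : Permutation (n G) size
      τ = remove zero ρ
      tail : Expr k size
      tail = proj₁ (dropFirst expr (τ ⟨$⟩ʳ x))
      tail↪expr : eval tail ↪[ suc ] eval expr
      tail↪expr = proj₂ (dropFirst expr (τ ⟨$⟩ʳ x))
      adj-τ : ∀ i j → ladj (eval tail) (τ ⟨$⟩ʳ i) (τ ⟨$⟩ʳ j) ≡ adj G i j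
      adj-τ i j = begin
        ladj (eval tail) (τ ⟨$⟩ʳ i) (τ ⟨$⟩ʳ j)
          ≡⟨ adj-↪ tail↪expr _ _ ⟨
        ladj (eval expr) (suc (τ ⟨$⟩ʳ i)) (suc (τ ⟨$⟩ʳ j))
          ≡⟨ cong₂ (ladj (eval expr)) (lift₀-remove ρ perm-x (suc i)) (lift₀-remove ρ perm-x (suc j)) ⟩
        ladj (eval expr) (ρ ⟨$⟩ʳ suc i) (ρ ⟨$⟩ʳ suc j)
          ≡⟨ adj-↪ iso _ _ ⟩
        ladj (eval e) (π ⟨$⟩ʳ suc i) (π ⟨$⟩ʳ suc j)
          ≡⟨ h (suc i) (suc j) ⟩
        adj G i j ∎
        where open ≡-Reasoning

  module Isolation
    (isolate : ∀ {k n} → Expr k n → Fin n → Expr (suc k) n)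
    (adj-isolate : ∀ {k n} (e : Expr k n) y x z → ladj (eval (isolate e y)) x z ≡ ladj (eval e) x z)
    (lab-isolate-self : ∀ {k n} (e : Expr k n) y → lab (eval (isolate e y)) y ≡ zero)
    (lab-isolate-other : ∀ {k n} (e : Expr k n) {x y} → x ≢ y → lab (eval (isolate e y)) x ≡ suc (lab (eval e) x))
    where

    isolateAll : ∀ {d k n} → (Fin d → Fin n) → Expr k n → Expr (d + k) n
    isolateAll {zero}  f e = e
    isolateAll {suc d} f e = isolate (isolateAll (f ∘ suc) e) (f zero)

    module _ {k n : ℕ} (e : Expr k n) where

      adj-isolateAll : ∀ {d} (f : Fin d → Fin n) x z → ladj (eval (isolateAll f e)) x z ≡ ladj (eval e) x z
      adj-isolateAll {zero}  f x z = refl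
      adj-isolateAll {suc d} f x z = trans (adj-isolate (isolateAll (f ∘ suc) e) (f zero) x z) (adj-isolateAll (f ∘ suc) x z)

      lab-isolateAll-∈ : ∀ {d} {f : Fin d → Fin n} → Injective _≡_ _≡_ f → ∀ i →
                         lab (eval (isolateAll f e)) (f i) ≡ i ↑ˡ k
      lab-isolateAll-∈ {f = f} f-inj zero = lab-isolate-self (isolateAll (f ∘ suc) e) (f zero)
      lab-isolateAll-∈ {f = f} f-inj (suc i) =
        trans (lab-isolate-other (isolateAll (f ∘ suc) e) (0≢1+n ∘ sym ∘ f-inj))
              (cong suc (lab-isolateAll-∈ (suc-injective ∘ f-inj) i))

      lab-isolateAll-∉ : ∀ {d} {f : Fin d → Fin n} {x} → (∀ i → f i ≢ x) →
                         lab (eval (isolateAll f e)) x ≡ d ↑ʳ lab (eval e) x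
      lab-isolateAll-∉ {zero}      f∌x = refl
      lab-isolateAll-∉ {suc d} {f} f∌x =
        trans (lab-isolate-other (isolateAll (f ∘ suc) e) (f∌x zero ∘ sym)) (cong suc (lab-isolateAll-∉ (f∌x ∘ suc)))

      inImage-lab-isolateAll : ∀ {d} {f : Fin d → Fin n} → Injective _≡_ _≡_ f → ∀ x →
                               inImage (_↑ˡ k) (lab (eval (isolateAll f e)) x) ≡ inImage f x
      inImage-lab-isolateAll {d} {f} f-inj x with any? (λ i → f i ≟ x)
      ... | yes (i , refl) rewrite lab-isolateAll-∈ f-inj i = trans (inImage-∈ (_↑ˡ k) i) (sym (inImage-∈ f i))
      ... | no ∄i rewrite lab-isolateAll-∉ (λ i fi≡x → ∄i (i , fi≡x)) =
        trans (inImage-∉ (λ i → ↑ˡ≢↑ʳ {m = d} {p = k} i (lab (eval e) x)))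
              (sym (inImage-∉ (λ i fi≡x → ∄i (i , fi≡x))))

module CliqueWidth where

  open Expressions cwEval

  -- cw-union, cw-relab a b and cw-edges a b evaluate to joinLG noEdges,
  -- relabelLG (cwRelabel a b) and addEdgesLG (edgeTerm a b).
  noEdges : ∀ {k} → Fin k → Fin k → Bool
  noEdges _ _ = false

  cwRelabel : ∀ {k} → Fin k → Fin k → Fin k → Fin k
  cwRelabel a b c = if c == a then b else c

  edgeTerm : ∀ {k} → Fin k → Fin k → Fin k → Fin k → Bool
  edgeTerm a b p q = (p == a ∧ q == b) ∨ (p == b ∧ q == a)

  edgeTerm-diag : ∀ {k} {a b : Fin k} → a ≢ b → ∀ c → edgeTerm a b c c ≡ false
  edgeTerm-diag {a = a} {b} a≢b c with c ≟ a
  ... | yes refl rewrite ==-≢ a≢b = refl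
  ... | no _ = ∧-zeroʳ (c == b)

  edgeTerm-sym : ∀ {k} (a b p q : Fin k) → edgeTerm a b p q ≡ edgeTerm a b q p
  edgeTerm-sym a b p q = solve 4 (λ pa qb pb qa → (pa :* qb) :+ (pb :* qa) := (qa :* pb) :+ (qb :* pa)) refl
    (p == a) (q == b) (p == b) (q == a)

  edgeTerm-suc : ∀ {k} (a b p q : Fin k) → edgeTerm (suc a) (suc b) (suc p) (suc q) ≡ edgeTerm a b p q
  edgeTerm-suc a b p q = cong₂ _∨_ (cong₂ _∧_ (==-suc p a) (==-suc q b)) (cong₂ _∧_ (==-suc p b) (==-suc q a))

  cwRelabel-suc : ∀ {k} (a b c : Fin k) → cwRelabel (suc a) (suc b) (suc c) ≡ suc (cwRelabel a b c)
  cwRelabel-suc a b c rewrite ==-suc c a = sym (if-float suc (c == a))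

  ladj-sym : ∀ {k n} (e : CWExpr k n) x y → ladj (cwEval e) x y ≡ ladj (cwEval e) y x
  ladj-sym (cw-vertex _) zero zero = refl
  ladj-sym (cw-union {m} {p} e₁ e₂) x y with splitView m p x | splitView m p y
  ... | inl u | inl v rewrite joinAdj-↑ˡ-↑ˡ (ladj (cwEval e₁)) (ladj (cwEval e₂)) (λ _ _ → false) u v
                            | joinAdj-↑ˡ-↑ˡ (ladj (cwEval e₁)) (ladj (cwEval e₂)) (λ _ _ → false) v u = ladj-sym e₁ u v
  ... | inl u | inr w rewrite joinAdj-↑ˡ-↑ʳ (ladj (cwEval e₁)) (ladj (cwEval e₂)) (λ _ _ → false) u w
                            | joinAdj-↑ʳ-↑ˡ (ladj (cwEval e₁)) (ladj (cwEval e₂)) (λ _ _ → false) w u = refl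
  ... | inr w | inl u rewrite joinAdj-↑ʳ-↑ˡ (ladj (cwEval e₁)) (ladj (cwEval e₂)) (λ _ _ → false) w u
                            | joinAdj-↑ˡ-↑ʳ (ladj (cwEval e₁)) (ladj (cwEval e₂)) (λ _ _ → false) u w = refl
  ... | inr w | inr w′ rewrite joinAdj-↑ʳ-↑ʳ (ladj (cwEval e₁)) (ladj (cwEval e₂)) (λ _ _ → false) w w′
                             | joinAdj-↑ʳ-↑ʳ (ladj (cwEval e₁)) (ladj (cwEval e₂)) (λ _ _ → false) w′ w = ladj-sym e₂ w w′
  ladj-sym (cw-relab _ _ _ e) = ladj-sym e
  ladj-sym (cw-edges a b _ e) x y = cong₂ _∨_ (ladj-sym e x y) (edgeTerm-sym a b (lab (cwEval e) x) (lab (cwEval e) y))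

  ladj-irrefl : ∀ {k n} (e : CWExpr k n) x → ladj (cwEval e) x x ≡ false
  ladj-irrefl (cw-vertex _) zero = refl
  ladj-irrefl (cw-union {m} {p} e₁ e₂) x with splitView m p x
  ... | inl u = trans (joinAdj-↑ˡ-↑ˡ (ladj (cwEval e₁)) (ladj (cwEval e₂)) (λ _ _ → false) u u) (ladj-irrefl e₁ u)
  ... | inr w = trans (joinAdj-↑ʳ-↑ʳ (ladj (cwEval e₁)) (ladj (cwEval e₂)) (λ _ _ → false) w w) (ladj-irrefl e₂ w)
  ladj-irrefl (cw-relab _ _ _ e) = ladj-irrefl e
  ladj-irrefl (cw-edges a b a≢b e) x rewrite ladj-irrefl e x = edgeTerm-diag a≢b (lab (cwEval e) x)

  someVertex : ∀ {k n} → CWExpr k n → Fin n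
  someVertex (cw-vertex _) = zero
  someVertex (cw-union {n = p} e _) = someVertex e ↑ˡ p
  someVertex (cw-relab _ _ _ e) = someVertex e
  someVertex (cw-edges _ _ _ e) = someVertex e

  front : ∀ {k n} (e : CWExpr k n) x → Front e x
  front (cw-vertex c) zero = record { expr = cw-vertex c ; perm = id ; perm-x = refl ; iso = ↪-refl }
  front (cw-union {m} {p} e₁ e₂) x with splitView m p x
  ... | inl u = record
    { expr = cw-union expr e₂
    ; perm = perm ⊕ₚ id
    ; perm-x = trans (⊕ᶠ-↑ˡ (perm ⟨$⟩ʳ_) (λ w → w) u) (cong (_↑ˡ p) perm-x)
    ; iso = joinLG-↪ noEdges iso ↪-refl }
    where open Front (front e₁ u)
  ... | inr w = record
    { expr = cw-union expr e₁
    ; perm = swapₚ m p ∘ₚ (perm ⊕ₚ id)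
    ; perm-x = trans (cong ((perm ⊕ₚ id) ⟨$⟩ʳ_) (swapᶠ-↑ʳ {m} {p} w))
                     (trans (⊕ᶠ-↑ˡ (perm ⟨$⟩ʳ_) (λ u → u) w) (cong (_↑ˡ m) perm-x))
    ; iso = ↪-trans (joinLG-swap noEdges (cwEval e₁) (cwEval e₂)) (joinLG-↪ noEdges iso ↪-refl) }
    where open Front (front e₂ w)
  front (cw-relab a b a≢b e) x = record
    { expr = cw-relab a b a≢b expr ; perm = perm ; perm-x = perm-x ; iso = relabelLG-↪ {R = cwRelabel a b} iso }
    where open Front (front e x)
  front (cw-edges a b a≢b e) x = record
    { expr = cw-edges a b a≢b expr ; perm = perm ; perm-x = perm-x ; iso = addEdgesLG-↪ {P = edgeTerm a b} iso }
    where open Front (front e x)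

  dropFirst : ∀ {k N} (e : CWExpr k N) → Fin (pred N) → Σ (CWExpr k (pred N)) λ e′ → cwEval e′ ↪[ sucᵖ ] cwEval e
  dropFirst (cw-union {zero} e₁ e₂) _ with someVertex e₁
  ... | ()
  dropFirst (cw-union {suc zero} e₁ e₂) _ = e₂ , joinLG-↪ʳ noEdges (cwEval e₁) (cwEval e₂)
  dropFirst (cw-union {suc (suc m)} e₁ e₂) _ =
    let (e₁′ , e₁′↪e₁) = dropFirst e₁ zero in
    cw-union e₁′ e₂ , ↪-cong (⊕ᶠ-suc {suc m}) (joinLG-↪ noEdges e₁′↪e₁ ↪-refl)
  dropFirst (cw-relab a b a≢b e) x =
    let (e′ , e′↪e) = dropFirst e x in cw-relab a b a≢b e′ , relabelLG-↪ {R = cwRelabel a b} e′↪e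
  dropFirst (cw-edges a b a≢b e) x =
    let (e′ , e′↪e) = dropFirst e x in cw-edges a b a≢b e′ , addEdgesLG-↪ {P = edgeTerm a b} e′↪e

  open Deletion front dropFirst

  hasCW-deleteVertex : ∀ {a b} G N → HasCW a G → HasCW b (insertVertex G N) → HasCW b G
  hasCW-deleteVertex G N (e , _) = expressible-deleteVertex G N (someVertex e)

  lift : ∀ {k n} → CWExpr k n → CWExpr (suc k) n
  lift (cw-vertex c)        = cw-vertex (suc c)
  lift (cw-union e₁ e₂)     = cw-union (lift e₁) (lift e₂)
  lift (cw-relab a b a≢b e) = cw-relab (suc a) (suc b) (a≢b ∘ suc-injective) (lift e)
  lift (cw-edges a b a≢b e) = cw-edges (suc a) (suc b) (a≢b ∘ suc-injective) (lift e)

  lab-lift : ∀ {k n} (e : CWExpr k n) x → lab (cwEval (lift e)) x ≡ suc (lab (cwEval e) x)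
  lab-lift (cw-vertex c) zero = refl
  lab-lift (cw-union e₁ e₂) = joinLab-∘ suc (lab-lift e₁) (lab-lift e₂)
  lab-lift (cw-relab a b _ e) x rewrite lab-lift e x = cwRelabel-suc a b _
  lab-lift (cw-edges _ _ _ e) = lab-lift e

  adj-lift : ∀ {k n} (e : CWExpr k n) x y → ladj (cwEval (lift e)) x y ≡ ladj (cwEval e) x y
  adj-lift (cw-vertex _) zero zero = refl
  adj-lift (cw-union e₁ e₂) = joinAdj-cong (adj-lift e₁) (adj-lift e₂) (λ _ _ → refl)
  adj-lift (cw-relab _ _ _ e) = adj-lift e
  adj-lift (cw-edges a b _ e) x y = cong₂ _∨_ (adj-lift e x y)
    (trans (cong₂ (edgeTerm (suc a) (suc b)) (lab-lift e x) (lab-lift e y))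
           (edgeTerm-suc a b (lab (cwEval e) x) (lab (cwEval e) y)))

  edgesIf : ∀ {k n} → Bool → (a b : Fin k) → a ≢ b → CWExpr k n → CWExpr k n
  edgesIf false _ _ _   e = e
  edgesIf true  a b a≢b e = cw-edges a b a≢b e

  module _ {k n : ℕ} (a b : Fin k) (a≢b : a ≢ b) (e : CWExpr k n) where

    lab-edgesIf : ∀ t x → lab (cwEval (edgesIf t a b a≢b e)) x ≡ lab (cwEval e) x
    lab-edgesIf false x = refl
    lab-edgesIf true  x = refl

    adj-edgesIf : ∀ t x y → ladj (cwEval (edgesIf t a b a≢b e)) x y
                          ≡ ladj (cwEval e) x y ∨ (t ∧ edgeTerm a b (lab (cwEval e) x) (lab (cwEval e) y))
    adj-edgesIf false x y = sym (∨-identityʳ _)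
    adj-edgesIf true  x y = refl

  edgeTerm-isolated : ∀ {k} {a b : Fin k} → a ≢ b → ∀ c p q →
    (edgeTerm (suc a) (suc b) p q ∨ ((c == b) ∧ edgeTerm zero (suc a) p q)) ∨ ((c == a) ∧ edgeTerm zero (suc b) p q)
    ≡ edgeTerm a b (decode c p) (decode c q)
  edgeTerm-isolated a≢b c zero zero =
    trans (solve 2 (λ ca cb → (cb :* con false) :+ (ca :* con false) := con false) refl (c == _) (c == _))
          (sym (edgeTerm-diag a≢b c))
  edgeTerm-isolated {a = a} {b} a≢b c zero (suc q) =
    trans (solve 4 (λ ca cb qa qb → (cb :* (qa :+ con false)) :+ (ca :* (qb :+ con false)) := (ca :* qb) :+ (cb :* qa)) refl
                 (c == a) (c == b) (suc q == suc a) (suc q == suc b))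
          (cong₂ (λ qa qb → (c == a ∧ qb) ∨ (c == b ∧ qa)) (==-suc q a) (==-suc q b))
  edgeTerm-isolated {a = a} {b} a≢b c (suc p) zero =
    trans (solve 4 (λ ca cb pa pb → (((pa :* con false) :+ (pb :* con false)) :+ (cb :* (pa :* con true))) :+ (ca :* (pb :* con true))
                                    := (pa :* cb) :+ (pb :* ca)) refl
                 (c == a) (c == b) (suc p == suc a) (suc p == suc b))
          (cong₂ (λ pa pb → (pa ∧ c == b) ∨ (pb ∧ c == a)) (==-suc p a) (==-suc p b))
  edgeTerm-isolated {a = a} {b} a≢b c (suc p) (suc q) =
    trans (solve 5 (λ t ca cb pa pb → (t :+ (cb :* (pa :* con false))) :+ (ca :* (pb :* con false)) := t) refl
                 (edgeTerm (suc a) (suc b) (suc p) (suc q)) (c == a) (c == b) (suc p == suc a) (suc p == suc b))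
          (edgeTerm-suc a b p q)

  isolate : ∀ {k n} → CWExpr k n → Fin n → CWExpr (suc k) n
  isolate (cw-vertex _) _ = cw-vertex zero
  isolate (cw-union {m} {p} e₁ e₂) y with splitView m p y
  ... | inl u = cw-union (isolate e₁ u) (lift e₂)
  ... | inr w = cw-union (lift e₁) (isolate e₂ w)
  isolate (cw-relab a b a≢b e) y = cw-relab (suc a) (suc b) (a≢b ∘ suc-injective) (isolate e y)
  -- y has left its current label c for the private label zero, so the edges
  -- that η_{a,b} gives y through c are added separately.
  isolate (cw-edges a b a≢b e) y =
    edgesIf (c == a) zero (suc b) 0≢1+n (edgesIf (c == b) zero (suc a) 0≢1+n
      (cw-edges (suc a) (suc b) (a≢b ∘ suc-injective) (isolate e y)))
    where c = lab (cwEval e) y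

  lab-isolate-self : ∀ {k n} (e : CWExpr k n) y → lab (cwEval (isolate e y)) y ≡ zero
  lab-isolate-self (cw-vertex _) zero = refl
  lab-isolate-self (cw-union {m} {p} e₁ e₂) y with splitView m p y
  ... | inl u = trans (joinLab-↑ˡ {m = m} {p = p} _ _ u) (lab-isolate-self e₁ u)
  ... | inr w = trans (joinLab-↑ʳ {m = m} {p = p} _ _ w) (lab-isolate-self e₂ w)
  lab-isolate-self (cw-relab a b a≢b e) y rewrite lab-isolate-self e y = refl
  lab-isolate-self (cw-edges a b a≢b e) y =
    trans (lab-edgesIf zero (suc b) 0≢1+n _ (c == a) y)
          (trans (lab-edgesIf zero (suc a) 0≢1+n _ (c == b) y) (lab-isolate-self e y))
    where c = lab (cwEval e) y

  lab-isolate-other : ∀ {k n} (e : CWExpr k n) {x y} → x ≢ y →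
                        lab (cwEval (isolate e y)) x ≡ suc (lab (cwEval e) x)
  lab-isolate-other (cw-vertex _) {zero} {zero} x≢y = contradiction refl x≢y
  lab-isolate-other (cw-union {m} {p} e₁ e₂) {x} {y} x≢y with splitView m p y | splitView m p x
  ... | inl u | inl u′ = joinLab-∘-↑ˡ {m = m} {p = p} suc u′ (lab-isolate-other e₁ (x≢y ∘ cong (_↑ˡ p)))
  ... | inl u | inr w′ = joinLab-∘-↑ʳ {m = m} {p = p} suc w′ (lab-lift e₂ w′)
  ... | inr w | inl u′ = joinLab-∘-↑ˡ {m = m} {p = p} suc u′ (lab-lift e₁ u′)
  ... | inr w | inr w′ = joinLab-∘-↑ʳ {m = m} {p = p} suc w′ (lab-isolate-other e₂ (x≢y ∘ cong (m ↑ʳ_)))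
  lab-isolate-other (cw-relab a b a≢b e) {x} x≢y rewrite lab-isolate-other e x≢y = cwRelabel-suc a b (lab (cwEval e) x)
  lab-isolate-other (cw-edges a b a≢b e) {x} {y} x≢y =
    trans (lab-edgesIf zero (suc b) 0≢1+n _ (c == a) x)
          (trans (lab-edgesIf zero (suc a) 0≢1+n _ (c == b) x) (lab-isolate-other e x≢y))
    where c = lab (cwEval e) y

  adj-isolate : ∀ {k n} (e : CWExpr k n) y x z → ladj (cwEval (isolate e y)) x z ≡ ladj (cwEval e) x z
  adj-isolate (cw-vertex _) zero zero zero = refl
  adj-isolate (cw-union {m} {p} e₁ e₂) y with splitView m p y
  ... | inl u = joinAdj-cong (adj-isolate e₁ u) (adj-lift e₂) (λ _ _ → refl)
  ... | inr w = joinAdj-cong (adj-lift e₁) (adj-isolate e₂ w) (λ _ _ → refl)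
  adj-isolate (cw-relab _ _ _ e) y = adj-isolate e y
  adj-isolate (cw-edges a b a≢b e) y x z = begin
    ladj (cwEval (edgesIf (c == a) zero (suc b) 0≢1+n E₁)) x z
      ≡⟨ adj-edgesIf zero (suc b) 0≢1+n E₁ (c == a) x z ⟩
    ladj (cwEval E₁) x z ∨ ((c == a) ∧ edgeTerm zero (suc b) (lab (cwEval E₁) x) (lab (cwEval E₁) z))
      ≡⟨ cong₂ (λ l l′ → ladj (cwEval E₁) x z ∨ ((c == a) ∧ edgeTerm zero (suc b) l l′))
               (lab-edgesIf zero (suc a) 0≢1+n E₀ (c == b) x) (lab-edgesIf zero (suc a) 0≢1+n E₀ (c == b) z) ⟩
    ladj (cwEval E₁) x z ∨ ((c == a) ∧ edgeTerm zero (suc b) (l′ x) (l′ z))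
      ≡⟨ cong (_∨ ((c == a) ∧ edgeTerm zero (suc b) (l′ x) (l′ z))) (adj-edgesIf zero (suc a) 0≢1+n E₀ (c == b) x z) ⟩
    ((ladj (cwEval e′) x z ∨ t₁) ∨ t₂) ∨ t₃
      ≡⟨ trans (cong (_∨ t₃) (∨-assoc (ladj (cwEval e′) x z) t₁ t₂))
               (∨-assoc (ladj (cwEval e′) x z) (t₁ ∨ t₂) t₃) ⟩
    ladj (cwEval e′) x z ∨ ((t₁ ∨ t₂) ∨ t₃)
      ≡⟨ cong₂ _∨_ (adj-isolate e y x z) (edgeTerm-isolated a≢b c (l′ x) (l′ z)) ⟩
    ladj (cwEval e) x z ∨ edgeTerm a b (decode c (l′ x)) (decode c (l′ z))
      ≡⟨ cong₂ (λ l l″ → ladj (cwEval e) x z ∨ edgeTerm a b l l″) (decode-l′ x) (decode-l′ z) ⟩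
    ladj (cwEval e) x z ∨ edgeTerm a b (lab (cwEval e) x) (lab (cwEval e) z) ∎
    where
    open ≡-Reasoning
    c = lab (cwEval e) y
    e′ = isolate e y
    l′ = lab (cwEval e′)
    E₀ = cw-edges (suc a) (suc b) (a≢b ∘ suc-injective) e′
    E₁ = edgesIf (c == b) zero (suc a) 0≢1+n E₀
    t₁ = edgeTerm (suc a) (suc b) (l′ x) (l′ z)
    t₂ = (c == b) ∧ edgeTerm zero (suc a) (l′ x) (l′ z)
    t₃ = (c == a) ∧ edgeTerm zero (suc b) (l′ x) (l′ z)
    decode-l′ = decode-isolated (lab-isolate-self e y) (lab-isolate-other e)

  pendant : ∀ {k n} → CWExpr k n → CWExpr (suc k) (suc n)
  pendant (cw-vertex c)        = cw-edges zero (suc c) 0≢1+n (cw-union (cw-vertex zero) (cw-vertex (suc c)))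
  pendant (cw-union e₁ e₂)     = cw-union (pendant e₁) (lift e₂)
  pendant (cw-relab a b a≢b e) = cw-relab (suc a) (suc b) (a≢b ∘ suc-injective) (pendant e)
  pendant (cw-edges a b a≢b e) = cw-edges (suc a) (suc b) (a≢b ∘ suc-injective) (pendant e)

  lab-pendant-zero : ∀ {k n} (e : CWExpr k n) → lab (cwEval (pendant e)) zero ≡ zero
  lab-pendant-zero (cw-vertex _)      = refl
  lab-pendant-zero (cw-union e₁ _)    = lab-pendant-zero e₁
  lab-pendant-zero (cw-relab _ _ _ e) rewrite lab-pendant-zero e = refl
  lab-pendant-zero (cw-edges _ _ _ e) = lab-pendant-zero e

  lab-pendant-suc : ∀ {k n} (e : CWExpr k n) x → lab (cwEval (pendant e)) (suc x) ≡ suc (lab (cwEval e) x)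
  lab-pendant-suc (cw-vertex _) zero = refl
  lab-pendant-suc (cw-union {m} {p} e₁ e₂) x with splitView m p x
  ... | inl u = trans (joinLab-↑ˡ {m = suc m} {p = p} _ _ (suc u))
    (trans (lab-pendant-suc e₁ u) (cong suc (sym (joinLab-↑ˡ {m = m} {p = p} _ _ u))))
  ... | inr w = trans (joinLab-↑ʳ {m = suc m} {p = p} _ _ w)
    (trans (lab-lift e₂ w) (cong suc (sym (joinLab-↑ʳ {m = m} {p = p} _ _ w))))
  lab-pendant-suc (cw-relab a b _ e) x rewrite lab-pendant-suc e x = cwRelabel-suc a b (lab (cwEval e) x)
  lab-pendant-suc (cw-edges _ _ _ e) = lab-pendant-suc e

  adj-pendant-suc : ∀ {k n} (e : CWExpr k n) x y → ladj (cwEval (pendant e)) (suc x) (suc y) ≡ ladj (cwEval e) x y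
  adj-pendant-suc (cw-vertex c) zero zero = ∧-zeroʳ (suc c == suc c)
  adj-pendant-suc (cw-union {m} {p} e₁ e₂) x y with splitView m p x | splitView m p y
  ... | inl u | inl v = trans (joinAdj-↑ˡ-↑ˡ {m = suc m} {p = p} _ _ _ (suc u) (suc v))
    (trans (adj-pendant-suc e₁ u v) (sym (joinAdj-↑ˡ-↑ˡ {m = m} {p = p} _ _ _ u v)))
  ... | inl u | inr w = trans (joinAdj-↑ˡ-↑ʳ {m = suc m} {p = p} _ _ _ (suc u) w)
                              (sym (joinAdj-↑ˡ-↑ʳ {m = m} {p = p} _ _ _ u w))
  ... | inr w | inl u = trans (joinAdj-↑ʳ-↑ˡ {m = suc m} {p = p} _ _ _ w (suc u))
                              (sym (joinAdj-↑ʳ-↑ˡ {m = m} {p = p} _ _ _ w u))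
  ... | inr w | inr w′ = trans (joinAdj-↑ʳ-↑ʳ {m = suc m} {p = p} _ _ _ w w′)
    (trans (adj-lift e₂ w w′) (sym (joinAdj-↑ʳ-↑ʳ {m = m} {p = p} _ _ _ w w′)))
  adj-pendant-suc (cw-relab _ _ _ e) = adj-pendant-suc e
  adj-pendant-suc (cw-edges a b _ e) x y = cong₂ _∨_ (adj-pendant-suc e x y)
    (trans (cong₂ (edgeTerm (suc a) (suc b)) (lab-pendant-suc e x) (lab-pendant-suc e y))
           (edgeTerm-suc a b (lab (cwEval e) x) (lab (cwEval e) y)))

  isZero : ∀ {n} → Fin n → Bool
  isZero zero    = true
  isZero (suc _) = false

  adj-pendant-zero : ∀ {k n} (e : CWExpr k n) y → ladj (cwEval (pendant e)) zero (suc y) ≡ isZero y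
  adj-pendant-zero (cw-vertex c) zero rewrite ==-refl (suc c) = refl
  adj-pendant-zero (cw-union {zero} e₁ e₂) y with someVertex e₁
  ... | ()
  adj-pendant-zero (cw-union {suc m} {p} e₁ e₂) y with splitView (suc m) p y
  ... | inl u = trans (joinAdj-↑ˡ-↑ˡ {m = suc (suc m)} {p = p} _ _ _ zero (suc u))
                      (trans (adj-pendant-zero e₁ u) (isZero-↑ˡ u))
    where
    isZero-↑ˡ : ∀ u → isZero u ≡ isZero (u ↑ˡ p)
    isZero-↑ˡ zero    = refl
    isZero-↑ˡ (suc _) = refl
  ... | inr w = joinAdj-↑ˡ-↑ʳ {m = suc (suc m)} {p = p} _ _ _ zero w
  adj-pendant-zero (cw-relab _ _ _ e) = adj-pendant-zero e
  adj-pendant-zero (cw-edges a b _ e) y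
    rewrite lab-pendant-zero e = trans (∨-identityʳ _) (adj-pendant-zero e y)

  connect : ∀ {k n d} (α : Fin k) (β : Fin d → Fin k) → (∀ i → α ≢ β i) → CWExpr k n → CWExpr k n
  connect {d = zero}  α β α∉β e = e
  connect {d = suc d} α β α∉β e = cw-edges α (β zero) (α∉β zero) (connect α (β ∘ suc) (α∉β ∘ suc) e)

  module _ {k n : ℕ} (α : Fin k) (e : CWExpr k n) where

    lab-connect : ∀ {d} (β : Fin d → Fin k) α∉β x → lab (cwEval (connect α β α∉β e)) x ≡ lab (cwEval e) x
    lab-connect {zero}  β α∉β x = refl
    lab-connect {suc d} β α∉β x = lab-connect (β ∘ suc) (α∉β ∘ suc) x

    adj-connect : ∀ {d} (β : Fin d → Fin k) α∉β x y →
                  ladj (cwEval (connect α β α∉β e)) x y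
                  ≡ ladj (cwEval e) x y ∨ ((lab (cwEval e) x == α) ∧ inImage β (lab (cwEval e) y))
                                        ∨ ((lab (cwEval e) y == α) ∧ inImage β (lab (cwEval e) x))
    adj-connect {zero} β α∉β x y =
      solve 3 (λ A X Y → A := A :+ ((X :* con false) :+ (Y :* con false))) refl (ladj (cwEval e) x y) (lx == α) (ly == α)
      where lx = lab (cwEval e) x ; ly = lab (cwEval e) y
    adj-connect {suc d} β α∉β x y = begin
      ladj (cwEval rest) x y ∨ edgeTerm α (β zero) (lab (cwEval rest) x) (lab (cwEval rest) y)
        ≡⟨ cong₂ _∨_ (adj-connect (β ∘ suc) (α∉β ∘ suc) x y)
                     (cong₂ (edgeTerm α (β zero)) (lab-connect (β ∘ suc) (α∉β ∘ suc) x)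
                                                  (lab-connect (β ∘ suc) (α∉β ∘ suc) y)) ⟩
      (A ∨ (X ∧ I) ∨ (Y ∧ I′)) ∨ ((X ∧ ly == β zero) ∨ (lx == β zero ∧ Y))
        ≡⟨ cong₂ (λ s t → (A ∨ (X ∧ I) ∨ (Y ∧ I′)) ∨ ((X ∧ s) ∨ (t ∧ Y)))
                 (==-sym ly (β zero)) (==-sym lx (β zero)) ⟩
      (A ∨ (X ∧ I) ∨ (Y ∧ I′)) ∨ ((X ∧ (β zero == ly)) ∨ ((β zero == lx) ∧ Y))
        ≡⟨ solve 7 (λ A X Y I J P Q → (A :+ ((X :* I) :+ (Y :* J))) :+ ((X :* P) :+ (Q :* Y))
                                      := A :+ ((X :* (P :+ I)) :+ (Y :* (Q :+ J)))) refl
                 A X Y I I′ (β zero == ly) (β zero == lx) ⟩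
      A ∨ (X ∧ ((β zero == ly) ∨ I)) ∨ (Y ∧ ((β zero == lx) ∨ I′)) ∎
      where
      open ≡-Reasoning
      rest = connect α (β ∘ suc) (α∉β ∘ suc) e
      lx = lab (cwEval e) x
      ly = lab (cwEval e) y
      A = ladj (cwEval e) x y
      X = lx == α
      Y = ly == α
      I = inImage (β ∘ suc) ly
      I′ = inImage (β ∘ suc) lx

  isZero-== : ∀ {n} (x : Fin (suc n)) → isZero x ≡ (zero == x)
  isZero-== zero    = refl
  isZero-== (suc _) = refl

  open Isolation isolate adj-isolate lab-isolate-self lab-isolate-other

  module AddVertex {k d} (G : Graph) (N : Fin (n G) → Bool) (enum : Enumeration N (suc d))
                   (e : CWExpr k (n G)) (π : Permutation′ (n G))
                   (h : ∀ i j → ladj (cwEval e) (π ⟨$⟩ʳ i) (π ⟨$⟩ʳ j) ≡ adj G i j) where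

    open Enumeration enum
    open Front (front e (π ⟨$⟩ʳ element zero))
    ρ : Permutation (n G) (suc size)
    ρ = π ∘ₚ perm

    ρ-inj : Injective _≡_ _≡_ (ρ ⟨$⟩ʳ_)
    ρ-inj = Injection.injective (↔⇒↣ ρ)

    g : Fin d → Fin (suc (suc size))
    g = suc ∘ (ρ ⟨$⟩ʳ_) ∘ element ∘ suc
    g-inj : Injective _≡_ _≡_ g
    g-inj = suc-injective ∘ injective ∘ ρ-inj ∘ suc-injective

    tagged : CWExpr (d + suc k) (suc (suc size))
    tagged = isolateAll g (pendant expr)

    label : Fin (suc (suc size)) → Fin (d + suc k)
    label = lab (cwEval tagged)

    new : Fin (d + suc k)
    new = d ↑ʳ zero

    new∉tags : ∀ i → new ≢ i ↑ˡ suc k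
    new∉tags i = ↑ˡ≢↑ʳ i zero ∘ sym

    E : CWExpr (d + suc k) (suc (suc size))
    E = connect new (_↑ˡ suc k) new∉tags tagged

    tag : Fin (suc (suc size)) → Bool
    tag x = inImage (_↑ˡ suc k) (label x)

    lab-new : label zero ≡ new
    lab-new = trans (lab-isolateAll-∉ (pendant expr) (λ i ())) (cong (d ↑ʳ_) (lab-pendant-zero expr))

    lab-old : ∀ y → (label (suc y) == new) ≡ false
    lab-old y with any? (λ i → g i ≟ suc y)
    ... | yes (i , refl) rewrite lab-isolateAll-∈ (pendant expr) g-inj i = ==-≢ (↑ˡ≢↑ʳ i zero)
    ... | no ∄i rewrite lab-isolateAll-∉ (pendant expr) (λ i gi≡y → ∄i (i , gi≡y)) | lab-pendant-suc expr y =
      ==-≢ (0≢1+n ∘ sym ∘ ↑ʳ-injective d _ _)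

    tagged-old : ∀ j → inImage (_↑ˡ suc k) (label (suc (ρ ⟨$⟩ʳ j))) ≡ inImage (element ∘ suc) j
    tagged-old j = trans (inImage-lab-isolateAll (pendant expr) g-inj _) (inImage-∘ (ρ-inj ∘ suc-injective) (element ∘ suc) j)

    isZero-ρ : ∀ j → isZero (ρ ⟨$⟩ʳ j) ≡ (element zero == j)
    isZero-ρ j = trans (isZero-== (ρ ⟨$⟩ʳ j))
                       (trans (cong (_== (ρ ⟨$⟩ʳ j)) (sym perm-x)) (==-injective ρ-inj (element zero) j))

    edge-new : ∀ j → ladj (cwEval E) zero (suc (ρ ⟨$⟩ʳ j)) ≡ N j
    edge-new j = begin
      ladj (cwEval E) zero (suc y)
        ≡⟨ adj-connect new tagged (_↑ˡ suc k) new∉tags zero (suc y) ⟩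
      ladj (cwEval tagged) zero (suc y) ∨ ((label zero == new) ∧ tag (suc y)) ∨ ((label (suc y) == new) ∧ tag zero)
        ≡⟨ cong₂ (λ a b → ladj (cwEval tagged) zero (suc y) ∨ (a ∧ tag (suc y)) ∨ (b ∧ tag zero))
                 (trans (cong (_== new) lab-new) (==-refl new)) (lab-old y) ⟩
      ladj (cwEval tagged) zero (suc y) ∨ (tag (suc y) ∨ false)
        ≡⟨ cong₂ _∨_ (adj-isolateAll (pendant expr) g zero (suc y)) (trans (∨-identityʳ _) (tagged-old j)) ⟩
      ladj (cwEval (pendant expr)) zero (suc y) ∨ inImage (element ∘ suc) j
        ≡⟨ cong (_∨ inImage (element ∘ suc) j) (trans (adj-pendant-zero expr y) (isZero-ρ j)) ⟩
      inImage element j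
        ≡⟨ inImage-element j ⟩
      N j ∎
      where
      open ≡-Reasoning
      y = ρ ⟨$⟩ʳ j

    edge-old : ∀ i j → ladj (cwEval E) (suc (ρ ⟨$⟩ʳ i)) (suc (ρ ⟨$⟩ʳ j)) ≡ adj G i j
    edge-old i j = begin
      ladj (cwEval E) (suc x) (suc y)
        ≡⟨ adj-connect new tagged (_↑ˡ suc k) new∉tags (suc x) (suc y) ⟩
      ladj (cwEval tagged) (suc x) (suc y) ∨ ((label (suc x) == new) ∧ tag (suc y)) ∨ ((label (suc y) == new) ∧ tag (suc x))
        ≡⟨ cong₂ (λ a b → ladj (cwEval tagged) (suc x) (suc y) ∨ (a ∧ tag (suc y)) ∨ (b ∧ tag (suc x)))
                 (lab-old x) (lab-old y) ⟩
      ladj (cwEval tagged) (suc x) (suc y) ∨ false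
        ≡⟨ ∨-identityʳ _ ⟩
      ladj (cwEval tagged) (suc x) (suc y)
        ≡⟨ adj-isolateAll (pendant expr) g (suc x) (suc y) ⟩
      ladj (cwEval (pendant expr)) (suc x) (suc y)
        ≡⟨ adj-pendant-suc expr x y ⟩
      ladj (cwEval expr) x y
        ≡⟨ adj-↪ iso (π ⟨$⟩ʳ i) (π ⟨$⟩ʳ j) ⟩
      ladj (cwEval e) (π ⟨$⟩ʳ i) (π ⟨$⟩ʳ j)
        ≡⟨ h i j ⟩
      adj G i j ∎
      where
      open ≡-Reasoning
      x = ρ ⟨$⟩ʳ i
      y = ρ ⟨$⟩ʳ j

    adj-E : ∀ i j → ladj (cwEval E) (lift₀ ρ ⟨$⟩ʳ i) (lift₀ ρ ⟨$⟩ʳ j) ≡ adj (insertVertex G N) i j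
    adj-E zero    zero    = ladj-irrefl E zero
    adj-E zero    (suc j) = edge-new j
    adj-E (suc i) zero    = trans (ladj-sym E _ _) (edge-new i)
    adj-E (suc i) (suc j) = edge-old i j

  hasCW-insertVertex : ∀ {k d} G N → Enumeration N d → HasCW k G → HasCW (k + d) (insertVertex G N)
  hasCW-insertVertex {k} {zero} G N enum (e , refl , π , h) =
    subst (λ w → HasCW w (insertVertex G N)) (sym (+-identityʳ k)) (expressible-≅ (insertVertex G N) E (lift₀ π) adj-E)
    where
    open Enumeration enum
    E = cw-union (cw-vertex (lab (cwEval e) (someVertex e))) e
    adj-E : ∀ i j → ladj (cwEval E) (lift₀ π ⟨$⟩ʳ i) (lift₀ π ⟨$⟩ʳ j) ≡ adj (insertVertex G N) i j
    adj-E zero    zero    = refl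
    adj-E zero    (suc j) = inImage-element j
    adj-E (suc i) zero    = inImage-element i
    adj-E (suc i) (suc j) = h i j
  hasCW-insertVertex {k} {suc d} G N enum (e , refl , π , h) =
    subst (λ w → HasCW w (insertVertex G N)) (trans (+-comm d (suc k)) (sym (+-suc k d)))
          (expressible-≅ (insertVertex G N) E (lift₀ ρ) adj-E)
    where open AddVertex G N enum e π h

module NLCWidth where

  open Expressions nlcEval

  someVertex : ∀ {k n} → NLCExpr k n → Fin n
  someVertex (nlc-vertex _) = zero
  someVertex (nlc-join {n = p} _ e _) = someVertex e ↑ˡ p
  someVertex (nlc-relab _ e) = someVertex e

  front : ∀ {k n} (e : NLCExpr k n) x → Front e x
  front (nlc-vertex c) zero = record { expr = nlc-vertex c ; perm = id ; perm-x = refl ; iso = ↪-refl }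
  front (nlc-join {m} {p} S e₁ e₂) x with splitView m p x
  ... | inl u = record
    { expr = nlc-join S expr e₂
    ; perm = perm ⊕ₚ id
    ; perm-x = trans (⊕ᶠ-↑ˡ (perm ⟨$⟩ʳ_) (λ w → w) u) (cong (_↑ˡ p) perm-x)
    ; iso = joinLG-↪ S iso ↪-refl }
    where open Front (front e₁ u)
  ... | inr w = record
    { expr = nlc-join (flip S) expr e₁
    ; perm = swapₚ m p ∘ₚ (perm ⊕ₚ id)
    ; perm-x = trans (cong ((perm ⊕ₚ id) ⟨$⟩ʳ_) (swapᶠ-↑ʳ {m} {p} w))
                     (trans (⊕ᶠ-↑ˡ (perm ⟨$⟩ʳ_) (λ u → u) w) (cong (_↑ˡ m) perm-x))
    ; iso = ↪-trans (joinLG-swap S (nlcEval e₁) (nlcEval e₂)) (joinLG-↪ (flip S) iso ↪-refl) }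
    where open Front (front e₂ w)
  front (nlc-relab R e) x = record
    { expr = nlc-relab R expr ; perm = perm ; perm-x = perm-x ; iso = relabelLG-↪ {R = R} iso }
    where open Front (front e x)

  dropFirst : ∀ {k N} (e : NLCExpr k N) → Fin (pred N) → Σ (NLCExpr k (pred N)) λ e′ → nlcEval e′ ↪[ sucᵖ ] nlcEval e
  dropFirst (nlc-join {zero} S e₁ e₂) _ with someVertex e₁
  ... | ()
  dropFirst (nlc-join {suc zero} S e₁ e₂) _ = e₂ , joinLG-↪ʳ S (nlcEval e₁) (nlcEval e₂)
  dropFirst (nlc-join {suc (suc m)} S e₁ e₂) _ =
    let (e₁′ , e₁′↪e₁) = dropFirst e₁ zero in
    nlc-join S e₁′ e₂ , ↪-cong (⊕ᶠ-suc {suc m}) (joinLG-↪ S e₁′↪e₁ ↪-refl)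
  dropFirst (nlc-relab R e) x =
    let (e′ , e′↪e) = dropFirst e x in nlc-relab R e′ , relabelLG-↪ {R = R} e′↪e

  open Deletion front dropFirst

  hasNLC-deleteVertex : ∀ {a b} G N → HasNLC a G → HasNLC b (insertVertex G N) → HasNLC b G
  hasNLC-deleteVertex G N (e , _) = expressible-deleteVertex G N (someVertex e)

  liftS : ∀ {k} → (Fin k → Fin k → Bool) → Fin (suc k) → Fin (suc k) → Bool
  liftS S (suc a) (suc b) = S a b
  liftS S _       _       = false

  liftR : ∀ {k} → (Fin k → Fin k) → Fin (suc k) → Fin (suc k)
  liftR R zero    = zero
  liftR R (suc a) = suc (R a)

  lift : ∀ {k n} → NLCExpr k n → NLCExpr (suc k) n
  lift (nlc-vertex c)     = nlc-vertex (suc c)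
  lift (nlc-join S e₁ e₂) = nlc-join (liftS S) (lift e₁) (lift e₂)
  lift (nlc-relab R e)    = nlc-relab (liftR R) (lift e)

  lab-lift : ∀ {k n} (e : NLCExpr k n) x → lab (nlcEval (lift e)) x ≡ suc (lab (nlcEval e) x)
  lab-lift (nlc-vertex c) zero = refl
  lab-lift (nlc-join S e₁ e₂) = joinLab-∘ suc (lab-lift e₁) (lab-lift e₂)
  lab-lift (nlc-relab R e) x rewrite lab-lift e x = refl

  adj-lift : ∀ {k n} (e : NLCExpr k n) x y → ladj (nlcEval (lift e)) x y ≡ ladj (nlcEval e) x y
  adj-lift (nlc-vertex c) zero zero = refl
  adj-lift (nlc-join S e₁ e₂) = joinAdj-cong (adj-lift e₁) (adj-lift e₂)
    (λ u w → cong₂ (liftS S) (lab-lift e₁ u) (lab-lift e₂ w))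
  adj-lift (nlc-relab R e) = adj-lift e

  isolate : ∀ {k n} → NLCExpr k n → Fin n → NLCExpr (suc k) n
  isolate (nlc-vertex _) _ = nlc-vertex zero
  isolate (nlc-join {m} {p} S e₁ e₂) y with splitView m p y
  ... | inl u = nlc-join (S on decode (lab (nlcEval e₁) u)) (isolate e₁ u) (lift e₂)
  ... | inr w = nlc-join (S on decode (lab (nlcEval e₂) w)) (lift e₁) (isolate e₂ w)
  isolate (nlc-relab R e) y = nlc-relab (liftR R) (isolate e y)

  lab-isolate-self : ∀ {k n} (e : NLCExpr k n) y → lab (nlcEval (isolate e y)) y ≡ zero
  lab-isolate-self (nlc-vertex _) zero = refl
  lab-isolate-self (nlc-join {m} {p} S e₁ e₂) y with splitView m p y
  ... | inl u = trans (joinLab-↑ˡ _ (lab (nlcEval (lift e₂))) u) (lab-isolate-self e₁ u)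
  ... | inr w = trans (joinLab-↑ʳ (lab (nlcEval (lift e₁))) _ w) (lab-isolate-self e₂ w)
  lab-isolate-self (nlc-relab R e) y rewrite lab-isolate-self e y = refl

  lab-isolate-other : ∀ {k n} (e : NLCExpr k n) {x y} → x ≢ y →
                         lab (nlcEval (isolate e y)) x ≡ suc (lab (nlcEval e) x)
  lab-isolate-other (nlc-vertex _) {zero} {zero} x≢y = contradiction refl x≢y
  lab-isolate-other (nlc-join {m} {p} S e₁ e₂) {x} {y} x≢y with splitView m p y | splitView m p x
  ... | inl u | inl u′ = joinLab-∘-↑ˡ {m = m} {p = p} suc u′ (lab-isolate-other e₁ (x≢y ∘ cong (_↑ˡ p)))
  ... | inl u | inr w′ = joinLab-∘-↑ʳ {m = m} {p = p} suc w′ (lab-lift e₂ w′)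
  ... | inr w | inl u′ = joinLab-∘-↑ˡ {m = m} {p = p} suc u′ (lab-lift e₁ u′)
  ... | inr w | inr w′ = joinLab-∘-↑ʳ {m = m} {p = p} suc w′ (lab-isolate-other e₂ (x≢y ∘ cong (m ↑ʳ_)))
  lab-isolate-other (nlc-relab R e) x≢y rewrite lab-isolate-other e x≢y = refl

  adj-isolate : ∀ {k n} (e : NLCExpr k n) y x z → ladj (nlcEval (isolate e y)) x z ≡ ladj (nlcEval e) x z
  adj-isolate (nlc-vertex _) zero zero zero = refl
  adj-isolate (nlc-join {m} {p} S e₁ e₂) y with splitView m p y
  ... | inl u = joinAdj-cong (adj-isolate e₁ u) (adj-lift e₂) λ u′ w →
    cong₂ S (decode-isolated (lab-isolate-self e₁ u) (lab-isolate-other e₁) u′)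
            (cong (decode (lab (nlcEval e₁) u)) (lab-lift e₂ w))
  ... | inr w = joinAdj-cong (adj-lift e₁) (adj-isolate e₂ w) λ u w′ →
    cong₂ S (cong (decode (lab (nlcEval e₂) w)) (lab-lift e₁ u))
            (decode-isolated (lab-isolate-self e₂ w) (lab-isolate-other e₂) w′)
  adj-isolate (nlc-relab R e) y = adj-isolate e y

  open Isolation isolate adj-isolate lab-isolate-self lab-isolate-other

  hasNLC-insertVertex : ∀ {k d} G N → Enumeration N d → HasNLC k G → HasNLC (k + d) (insertVertex G N)
  hasNLC-insertVertex {k} {d} G N enum (e , refl , π , h) =
    subst (λ w → HasNLC w (insertVertex G N)) (+-comm d k) (expressible-≅ (insertVertex G N) E (lift₀ π) adj-E)
    where
    open Enumeration enum
    π-inj : Injective _≡_ _≡_ (π ⟨$⟩ʳ_)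
    π-inj = Injection.injective (↔⇒↣ π)
    f : Fin d → Fin (n G)
    f = (π ⟨$⟩ʳ_) ∘ element
    tagged : NLCExpr (d + k) (n G)
    tagged = isolateAll f e
    -- the label of the new vertex is irrelevant
    E : NLCExpr (d + k) (suc (n G))
    E = nlc-join (λ _ β → inImage (_↑ˡ k) β) (nlc-vertex (lab (nlcEval tagged) (someVertex tagged))) tagged
    edge-new : ∀ j → inImage (_↑ˡ k) (lab (nlcEval tagged) (π ⟨$⟩ʳ j)) ≡ N j
    edge-new j = begin
      inImage (_↑ˡ k) (lab (nlcEval tagged) (π ⟨$⟩ʳ j)) ≡⟨ inImage-lab-isolateAll e (injective ∘ π-inj) _ ⟩
      inImage f (π ⟨$⟩ʳ j)                              ≡⟨ inImage-∘ π-inj element j ⟩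
      inImage element j                                 ≡⟨ inImage-element j ⟩
      N j                                               ∎
      where open ≡-Reasoning
    adj-E : ∀ i j → ladj (nlcEval E) (lift₀ π ⟨$⟩ʳ i) (lift₀ π ⟨$⟩ʳ j) ≡ adj (insertVertex G N) i j
    adj-E zero    zero    = refl
    adj-E zero    (suc j) = edge-new j
    adj-E (suc i) zero    = edge-new i
    adj-E (suc i) (suc j) = trans (adj-isolateAll e f _ _) (h i j)

open CliqueWidth using (hasCW-deleteVertex; hasCW-insertVertex)
open NLCWidth using (hasNLC-deleteVertex; hasNLC-insertVertex)

widthBounds : ∀ (Has : ℕ → Graph → Set) {G H d} →
              (∀ {a b} → Has a G → Has b H → Has b G) → (∀ {a} → Has a G → Has (a + d) H) →
              ∀ a b → Has a G × (∀ j → Has j G → a ≤ j) → Has b H × (∀ j → Has j H → b ≤ j) →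
              a ≤ b × b ≤ a + d
widthBounds Has delete insert a b (hasG , minG) (hasH , minH) = minG b (delete hasG hasH) , minH (a + _) (insert hasG)

corollary2 : (G : Graph) (N : Fin (n G) → Bool) (d : ℕ) → count N ≡ d
    → (∀ a b → IsNLCW G a → IsNLCW (insertVertex G N) b → a ≤ b × b ≤ a + d)
    × (∀ a b → IsCW G a → IsCW (insertVertex G N) b → a ≤ b × b ≤ a + d)
corollary2 G N .(count N) refl =
  widthBounds HasNLC (hasNLC-deleteVertex G N) (hasNLC-insertVertex G N (enumeration N)) ,
  widthBounds HasCW (hasCW-deleteVertex G N) (hasCW-insertVertex G N (enumeration N))
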